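{- Let $\mathcal{C}$ be an adequate set of formulas. Let $\Gamma\{\ \}\{\ \}$ be a sequent context with two holes such that, in its corresponding tree, there is an $i$-path from the node of the first hole to the node of the second hole. If $\Gamma\{[\Delta]_i\}\{\emptyset\}$ is provable in $\mathsf{GLP_{NS}}+\mathsf{cut}(\mathcal{C})$, then $\Gamma\{\emptyset\}\{[\Delta]_i\}$ is provable in $\mathsf{GLP_{NS}}+\mathsf{cut}(\mathcal{C})$.
   Context: Formulas are built from atoms $p$, complements $\overline{p}$, $\top,\bot$, $\wedge,\vee$, and $\Box_i,\Diamond_i$ ($i\in\mathbb{N}$); negation $\overline{A}$ is defined via De Morgan laws, $\overline{\overline{p}}=p$, $\overline{\top}=\bot$, $\overline{\bot}=\top$, $\overline{\Box_iA}=\Diamond_i\overline{A}$, $\overline{\Diamond_iA}=\Box_i\overline{A}$. A finite set of formulas is adequate if it is closed under subformulas and under negation. A nested sequent is (inductively) a finite multiset of formulas and of expressions $[\Delta]_i$ with $\Delta$ a nested sequent and $i\in\mathbb{N}$. The corresponding tree of $\Gamma=A_1,\dots,A_n,[\Delta_1]_{i_1},\dots,[\Delta_m]_{i_m}$ has root labelled by the multiset $A_1,\dots,A_n$ with, for each $k$, an edge labelled $i_k$ from the root to the root of the corresponding tree of $\Delta_k$; edges are directed away from the root. A sequent context with $n$ holes is a nested sequent with $n$ distinct holes, each in place of a formula and each occurring exactly once; a hole belongs to the node of the tree where it occurs; filling holes with sequents is defined in the obvious way, $\{\emptyset\}$ meaning the empty sequent. In the tree, an $i$-path from node $a_0$ to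 node $a_{k+l}$ is a path $a_0\leftarrow_{j_1}a_1\leftarrow_{j_2}\dots\leftarrow_{j_k}a_k\to_{j_{k+1}}a_{k+1}\to\dots\to_{j_{k+l}}a_{k+l}$ (each arrow an edge directed away from the root, labelled by $j_\cdot$; so it first goes up $k$ edges towards the root then down $l$ edges) such that $i<j_1,\dots,j_k$ and $i\le j_{k+1},\dots,j_{k+l}$ ($k,l\ge0$). A unary context $\Gamma\{\ \}$ is a one-hole context. $\mathsf{GLP_{NS}}$ has initial sequents $\Gamma\{p,\overline{p}\}$, $\Gamma\{\top\}$ and rules (premises / conclusion): $\Gamma\{A\}$, $\Gamma\{B\}$ / $\Gamma\{A\wedge B\}$; $\Gamma\{A,B\}$ / $\Gamma\{A\vee B\}$; $\Gamma\{[A,\Diamond_i\overline{A}]_i\}$ / $\Gamma\{\Box_iA\}$; $\Gamma\{\Diamond_iA,[A,\Delta]_j\}$ / $\Gamma\{\Diamond_iA,[\Delta]_j\}$ ($i\le j$); $\Gamma\{\Diamond_iA,[\Diamond_iA,\Delta]_j\}$ / $\Gamma\{\Diamond_iA,[\Delta]_j\}$ ($i\le j$); $\Gamma\{\Diamond_iA,[\Diamond_iA,\Delta]_j\}$ / $\Gamma\{[\Diamond_iA,\Delta]_j\}$ ($i<j$). $\mathsf{GLP_{NS}}+\mathsf{cut}(\mathcal{C})$ adds the rule $\Gamma\{A\}$, $\Gamma\{\overline{A}\}$ / $\Gamma\{\emptyset\}$ restricted to $A\in\mathcal{C}$. -}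

module Defs where

open import Data.Nat using (ℕ; _≤_; _<_)
open import Data.List using (List; []; _∷_; _++_)
open import Data.List.Membership.Propositional using (_∈_)
open import Data.List.Relation.Unary.All using (All)
open import Data.Product using (_×_)
open import Data.Unit using (⊤)

data Fml : Set where
  atom  : ℕ → Fml
  natom : ℕ → Fml
  tt ff : Fml
  _∧'_ _∨'_ : Fml → Fml → Fml
  □ ◇ : ℕ → Fml → Fml

neg : Fml → Fml
neg (atom p)  = natom p
neg (natom p) = atom p
neg tt        = ff
neg ff        = tt
neg (A ∧' B)  = neg A ∨' neg B
neg (A ∨' B)  = neg A ∧' neg B
neg (□ i A)   = ◇ i (neg A)
neg (◇ i A)   = □ i (neg A)

data _⊑_ : Fml → Fml → Set where
  ⊑-refl : ∀ {A} → A ⊑ A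
  ⊑-∧ˡ : ∀ {B A C} → B ⊑ A → B ⊑ (A ∧' C)
  ⊑-∧ʳ : ∀ {B A C} → B ⊑ C → B ⊑ (A ∧' C)
  ⊑-∨ˡ : ∀ {B A C} → B ⊑ A → B ⊑ (A ∨' C)
  ⊑-∨ʳ : ∀ {B A C} → B ⊑ C → B ⊑ (A ∨' C)
  ⊑-□  : ∀ {B A i} → B ⊑ A → B ⊑ □ i A
  ⊑-◇  : ∀ {B A i} → B ⊑ A → B ⊑ ◇ i A

record Adequate (𝒞 : List Fml) : Set where
  field
    sub-closed : ∀ {A B} → A ∈ 𝒞 → B ⊑ A → B ∈ 𝒞
    neg-closed : ∀ {A} → A ∈ 𝒞 → neg A ∈ 𝒞

-- Nested sequents: a node is a list of items (considered up to
-- permutation, see _~_ below, i.e. a multiset); an item is a formula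
-- or a bracket [Δ]_i.

data Item : Set where
  fml : Fml → Item
  bx  : ℕ → List Item → Item

Seq : Set
Seq = List Item

mutual
  data _≈I_ : Item → Item → Set where
    fml≈ : ∀ A → fml A ≈I fml A
    bx≈  : ∀ i {Δ Δ'} → Δ ~ Δ' → bx i Δ ≈I bx i Δ'

  data _~_ : Seq → Seq → Set where
    ~[]    : [] ~ []
    ~cons  : ∀ {x y xs ys} → x ≈I y → xs ~ ys → (x ∷ xs) ~ (y ∷ ys)
    ~swap  : ∀ {x y xs} → (x ∷ y ∷ xs) ~ (y ∷ x ∷ xs)
    ~trans : ∀ {xs ys zs} → xs ~ ys → ys ~ zs → xs ~ zs

-- One-hole contexts.  here Γ : hole at this node, the node also contains Γ;
-- down Γ j C : the node contains Γ and a bracket [C]_j containing the hole.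

data Ctx1 : Set where
  here : Seq → Ctx1
  down : Seq → ℕ → Ctx1 → Ctx1

plug : Ctx1 → Seq → Seq
plug (here Γ)     Δ = Δ ++ Γ
plug (down Γ j C) Δ = bx j (plug C Δ) ∷ Γ

labels : Ctx1 → List ℕ
labels (here _)     = []
labels (down _ j C) = j ∷ labels C

-- Two-hole contexts (every two-hole context arises this way, up to multiset order)
data Ctx2 : Set where
  both      : Seq → Ctx2
  hereThere : Seq → ℕ → Ctx1 → Ctx2
  thereHere : Seq → ℕ → Ctx1 → Ctx2
  split     : Seq → ℕ → Ctx1 → ℕ → Ctx1 → Ctx2
  down2     : Seq → ℕ → Ctx2 → Ctx2

fill2 : Ctx2 → Seq → Seq → Seq
fill2 (both Γ)            Δ₁ Δ₂ = Δ₁ ++ Δ₂ ++ Γ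
fill2 (hereThere Γ j C)   Δ₁ Δ₂ = Δ₁ ++ (bx j (plug C Δ₂) ∷ Γ)
fill2 (thereHere Γ j C)   Δ₁ Δ₂ = Δ₂ ++ (bx j (plug C Δ₁) ∷ Γ)
fill2 (split Γ j C k D)   Δ₁ Δ₂ = bx j (plug C Δ₁) ∷ bx k (plug D Δ₂) ∷ Γ
fill2 (down2 Γ j C)       Δ₁ Δ₂ = bx j (fill2 C Δ₁ Δ₂) ∷ Γ

-- There is an i-path from the node of hole 1 to the node of hole 2:
-- the (unique) tree path goes up from hole 1 to the lowest common ancestor
-- along edges with labels > i, then down to hole 2 along edges with labels ≥ i.
IPath : ℕ → Ctx2 → Set
IPath i (both _)            = ⊤
IPath i (hereThere _ j C)   = All (i ≤_) (j ∷ labels C)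
IPath i (thereHere _ j C)   = All (i <_) (j ∷ labels C)
IPath i (split _ j C k D)   = All (i <_) (j ∷ labels C) × All (i ≤_) (k ∷ labels D)
IPath i (down2 _ _ C)       = IPath i C

data ⊢[_]_ (𝒞 : List Fml) : Seq → Set where
  -- sequents are multisets
  exch : ∀ {Γ Γ'} → Γ ~ Γ' → ⊢[ 𝒞 ] Γ → ⊢[ 𝒞 ] Γ'
  ax   : ∀ Γ p → ⊢[ 𝒞 ] plug Γ (fml (atom p) ∷ fml (natom p) ∷ [])
  ax⊤  : ∀ Γ → ⊢[ 𝒞 ] plug Γ (fml tt ∷ [])
  r∧   : ∀ Γ A B → ⊢[ 𝒞 ] plug Γ (fml A ∷ []) → ⊢[ 𝒞 ] plug Γ (fml B ∷ [])
           → ⊢[ 𝒞 ] plug Γ (fml (A ∧' B) ∷ [])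
  r∨   : ∀ Γ A B → ⊢[ 𝒞 ] plug Γ (fml A ∷ fml B ∷ [])
           → ⊢[ 𝒞 ] plug Γ (fml (A ∨' B) ∷ [])
  r□   : ∀ Γ i A → ⊢[ 𝒞 ] plug Γ (bx i (fml A ∷ fml (◇ i (neg A)) ∷ []) ∷ [])
           → ⊢[ 𝒞 ] plug Γ (fml (□ i A) ∷ [])
  r◇₁  : ∀ Γ i j A Δ → i ≤ j
           → ⊢[ 𝒞 ] plug Γ (fml (◇ i A) ∷ bx j (fml A ∷ Δ) ∷ [])
           → ⊢[ 𝒞 ] plug Γ (fml (◇ i A) ∷ bx j Δ ∷ [])
  r◇₂  : ∀ Γ i j A Δ → i ≤ j
           → ⊢[ 𝒞 ] plug Γ (fml (◇ i A) ∷ bx j (fml (◇ i A) ∷ Δ) ∷ [])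
           → ⊢[ 𝒞 ] plug Γ (fml (◇ i A) ∷ bx j Δ ∷ [])
  r◇₃  : ∀ Γ i j A Δ → i < j
           → ⊢[ 𝒞 ] plug Γ (fml (◇ i A) ∷ bx j (fml (◇ i A) ∷ Δ) ∷ [])
           → ⊢[ 𝒞 ] plug Γ (bx j (fml (◇ i A) ∷ Δ) ∷ [])
  cut  : ∀ Γ A → A ∈ 𝒞 → ⊢[ 𝒞 ] plug Γ (fml A ∷ []) → ⊢[ 𝒞 ] plug Γ (fml (neg A) ∷ [])
           → ⊢[ 𝒞 ] plug Γ []

module Submission where

-- An i-path first climbs edges labelled > i and then descends edges
-- labelled ≥ i, so the move is a sequence of two elementary steps:
--   rising   Γ{[[Δ]_m, Σ]_l}  ⟶  Γ{[Δ]_m, [Σ]_l}    (m < l)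
--   sinking  Γ{[Δ]_m, [Σ]_l}  ⟶  Γ{[[Δ]_m, Σ]_l}    (m ≤ l)
-- Like weakening, both are local transformations of one node of the tree.
-- After basic facts on multisets, paths and the rules, the module Lifting
-- proves once and for all, by induction on derivations, that such a
-- transformation is admissible: a rule instance commutes with a
-- transformation acting elsewhere.  The one exception is a ◇-rule whose
-- bracket is moved; it is repaired by weakening (the first instance of the
-- general theorem) and further ◇-rules ("◇-stability").

open import Defs
open import Data.Nat using (ℕ; _≤_; _<_)
open import Data.Nat.Properties using (≤-trans; <-≤-trans; ≤-<-trans; <⇒≤; <-trans)
open import Data.List using (List; []; _∷_; _++_; map)
open import Data.List.Properties using (++-assoc)
open import Data.List.Membership.Propositional using (_∈_)
open import Data.List.Relation.Unary.All using (All; []; _∷_) renaming (map to All-map)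
open import Data.Product using (_×_; _,_; ∃-syntax)
open import Data.Empty using (⊥)
open import Data.Unit using (⊤) renaming (tt to unit)
open import Function using (_∘_; id)
open import Relation.Binary.PropositionalEquality using (_≡_; refl; sym; trans; cong; subst)

mutual
  ≈I-refl : ∀ x → x ≈I x
  ≈I-refl (fml A)  = fml≈ A
  ≈I-refl (bx i Δ) = bx≈ i (~-refl Δ)

  ~-refl : ∀ xs → xs ~ xs
  ~-refl []       = ~[]
  ~-refl (x ∷ xs) = ~cons (≈I-refl x) (~-refl xs)

mutual
  ≈I-sym : ∀ {x y} → x ≈I y → y ≈I x
  ≈I-sym (fml≈ A)  = fml≈ A
  ≈I-sym (bx≈ i p) = bx≈ i (~-sym p)

  ~-sym : ∀ {xs ys} → xs ~ ys → ys ~ xs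
  ~-sym ~[]          = ~[]
  ~-sym (~cons e p)  = ~cons (≈I-sym e) (~-sym p)
  ~-sym ~swap        = ~swap
  ~-sym (~trans p q) = ~trans (~-sym q) (~-sym p)

≈I-trans : ∀ {x y z} → x ≈I y → y ≈I z → x ≈I z
≈I-trans (fml≈ A)  (fml≈ .A)  = fml≈ A
≈I-trans (bx≈ i p) (bx≈ .i q) = bx≈ i (~trans p q)

infixr 4 _⟫_
_⟫_ : ∀ {xs ys zs} → xs ~ ys → ys ~ zs → xs ~ zs
_⟫_ = ~trans

≡⇒~ : ∀ {xs ys} → xs ≡ ys → xs ~ ys
≡⇒~ {xs} refl = ~-refl xs

~-∷ : ∀ x {xs ys} → xs ~ ys → (x ∷ xs) ~ (x ∷ ys)
~-∷ x p = ~cons (≈I-refl x) p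

~-bx : ∀ j Γ {xs ys} → xs ~ ys → (bx j xs ∷ Γ) ~ (bx j ys ∷ Γ)
~-bx j Γ p = ~cons (bx≈ j p) (~-refl Γ)

~-++ : ∀ X {Γ Γ'} → Γ ~ Γ' → (X ++ Γ) ~ (X ++ Γ')
~-++ []      p = p
~-++ (x ∷ X) p = ~-∷ x (~-++ X p)

~-shift : ∀ x X Γ → (x ∷ X ++ Γ) ~ (X ++ x ∷ Γ)
~-shift x []      Γ = ~-refl _
~-shift x (y ∷ X) Γ = ~swap ⟫ ~-∷ y (~-shift x X Γ)

~-exchange : ∀ E X Γ → (E ++ X ++ Γ) ~ (X ++ E ++ Γ)
~-exchange []      X Γ = ~-refl _
~-exchange (e ∷ E) X Γ = ~-∷ e (~-exchange E X Γ) ⟫ ~-shift e X (E ++ Γ)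

~-rot : ∀ a b c R → (a ∷ b ∷ c ∷ R) ~ (c ∷ a ∷ b ∷ R)
~-rot a b c R = ~-∷ a ~swap ⟫ ~swap

~-exchange-past : ∀ E X R Γ → (E ++ X ++ R ∷ Γ) ~ (X ++ R ∷ E ++ Γ)
~-exchange-past E X R Γ = ~-exchange E X (R ∷ Γ) ⟫ ~-++ X (~-sym (~-shift R E Γ))

data Sel : Seq → Item → Seq → Set where
  hd : ∀ {x S} → Sel (x ∷ S) x S
  tl : ∀ {y x S S'} → Sel S x S' → Sel (y ∷ S) x (y ∷ S')

sel-resp-~ : ∀ {S₀ S x S'} → S₀ ~ S → Sel S x S'
           → ∃[ x₀ ] ∃[ S₀' ] (Sel S₀ x₀ S₀' × x₀ ≈I x × S₀' ~ S')
sel-resp-~ (~cons e r) hd = _ , _ , hd , e , r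
sel-resp-~ (~cons e r) (tl s) with sel-resp-~ r s
... | x₀ , S₀' , s' , e' , r' = x₀ , _ , tl s' , e' , ~cons e r'
sel-resp-~ ~swap hd           = _ , _ , tl hd , ≈I-refl _ , ~-refl _
sel-resp-~ ~swap (tl hd)      = _ , _ , hd , ≈I-refl _ , ~-refl _
sel-resp-~ ~swap (tl (tl s))  = _ , _ , tl (tl s) , ≈I-refl _ , ~swap
sel-resp-~ (~trans p q) s with sel-resp-~ q s
... | x₁ , S₁ , s₁ , e₁ , r₁ with sel-resp-~ p s₁
... | x₀ , S₀' , s₀ , e₀ , r₀ = x₀ , S₀' , s₀ , ≈I-trans e₀ e₁ , ~trans r₀ r₁

selBx-resp-~ : ∀ {S₀ S k D S'} → S₀ ~ S → Sel S (bx k D) S'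
             → ∃[ D₀ ] ∃[ S₀' ] (Sel S₀ (bx k D₀) S₀' × D₀ ~ D × S₀' ~ S')
selBx-resp-~ e s with sel-resp-~ e s
... | .(bx _ _) , S₀' , s' , bx≈ k r , r' = _ , S₀' , s' , r , r'

fmls : List Fml → Seq
fmls = map fml

sel-after : ∀ X {Γ x Γ'} → Sel Γ x Γ' → Sel (X ++ Γ) x (X ++ Γ')
sel-after []      s = s
sel-after (y ∷ X) s = tl (sel-after X s)

selBx-past-fmls : ∀ F {Γ k D S'} → Sel (fmls F ++ Γ) (bx k D) S'
                → ∃[ Γ' ] (Sel Γ (bx k D) Γ' × S' ≡ fmls F ++ Γ')
selBx-past-fmls []      s = _ , s , refl
selBx-past-fmls (A ∷ F) (tl s) with selBx-past-fmls F s
... | Γ' , s' , refl = Γ' , s' , refl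

-- The rules act at one node; the proofs
-- below address that node by its path and name its content explicitly.
-- dn Γ j P : enter a bracket [ ]_j whose siblings are Γ, then follow P.
data Path : Set where
  top : Path
  dn  : Seq → ℕ → Path → Path

plugP : Path → Seq → Seq
plugP top        S = S
plugP (dn Γ j P) S = bx j (plugP P S) ∷ Γ

plugP-~ : ∀ P {S S'} → S ~ S' → plugP P S ~ plugP P S'
plugP-~ top        p = p
plugP-~ (dn Γ j P) p = ~-bx j Γ (plugP-~ P p)

extend : Path → Seq → ℕ → Path
extend top          Γ j = dn Γ j top
extend (dn Γ' j' P) Γ j = dn Γ' j' (extend P Γ j)

plugP-extend : ∀ P Γ j S → plugP (extend P Γ j) S ≡ plugP P (bx j S ∷ Γ)
plugP-extend top          Γ j S = refl
plugP-extend (dn Γ' j' P) Γ j S = cong (λ z → bx j' z ∷ Γ') (plugP-extend P Γ j S)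

focus-~ : ∀ P X l S Γ → plugP P (X ++ bx l S ∷ Γ) ~ plugP (extend P (X ++ Γ) l) S
focus-~ P X l S Γ =
  plugP-~ P (~-sym (~-shift (bx l S) X Γ)) ⟫ ≡⇒~ (sym (plugP-extend P (X ++ Γ) l S))

extracted-~ : ∀ P m D l S Γ → plugP P (bx m D ∷ bx l S ∷ Γ) ~ plugP (extend P (bx m D ∷ Γ) l) S
extracted-~ P m D l S Γ = plugP-~ P ~swap ⟫ focus-~ P [] l S (bx m D ∷ Γ)

toCtx : Path → Seq → Ctx1
toCtx top         Γ = here Γ
toCtx (dn Γ' j P) Γ = down Γ' j (toCtx P Γ)

plug-toCtx : ∀ P Γ Y → plug (toCtx P Γ) Y ≡ plugP P (Y ++ Γ)
plug-toCtx top         Γ Y = refl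
plug-toCtx (dn Γ' j P) Γ Y = cong (λ z → bx j z ∷ Γ') (plug-toCtx P Γ Y)

pathOf : Ctx1 → Path
pathOf (here _)     = top
pathOf (down Γ j C) = dn Γ j (pathOf C)

nodeOf : Ctx1 → Seq
nodeOf (here Γ)     = Γ
nodeOf (down _ _ C) = nodeOf C

plug-split : ∀ C Y → plug C Y ≡ plugP (pathOf C) (Y ++ nodeOf C)
plug-split (here Γ)     Y = refl
plug-split (down Γ j C) Y = cong (λ z → bx j z ∷ Γ) (plug-split C Y)

module Rules (𝒞 : List Fml) where

  infix 1 ⊢_
  ⊢_ : Seq → Set
  ⊢ S = ⊢[ 𝒞 ] S

  from-ctx : ∀ P Γ Y → ⊢ plug (toCtx P Γ) Y → ⊢ plugP P (Y ++ Γ)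
  from-ctx P Γ Y = subst ⊢_ (plug-toCtx P Γ Y)

  to-ctx : ∀ P Γ Y → ⊢ plugP P (Y ++ Γ) → ⊢ plug (toCtx P Γ) Y
  to-ctx P Γ Y = subst ⊢_ (sym (plug-toCtx P Γ Y))

  in-bracket : ∀ P X l Γ {S S'} → (∀ Q → ⊢ plugP Q S → ⊢ plugP Q S')
             → ⊢ plugP P (X ++ bx l S ∷ Γ) → ⊢ plugP P (X ++ bx l S' ∷ Γ)
  in-bracket P X l Γ f d =
    exch (~-sym (focus-~ P X l _ Γ)) (f (extend P (X ++ Γ) l) (exch (focus-~ P X l _ Γ) d))

  -- The rules acting on the formulas of a single node:
  -- principal formulas Xf, premises obtained by replacing Xf by each Y ∈ Ys.
  data NodeRule : List Fml → List Seq → Set where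
    axiom-rule : ∀ p → NodeRule (atom p ∷ natom p ∷ []) []
    ⊤-rule     : NodeRule (tt ∷ []) []
    ∧-rule     : ∀ A B → NodeRule (A ∧' B ∷ []) ((fml A ∷ []) ∷ (fml B ∷ []) ∷ [])
    ∨-rule     : ∀ A B → NodeRule (A ∨' B ∷ []) ((fml A ∷ fml B ∷ []) ∷ [])
    □-rule     : ∀ i A → NodeRule (□ i A ∷ []) ((bx i (fml A ∷ fml (◇ i (neg A)) ∷ []) ∷ []) ∷ [])
    cut-rule   : ∀ A → A ∈ 𝒞 → NodeRule [] ((fml A ∷ []) ∷ (fml (neg A) ∷ []) ∷ [])

  node-rule-sound : ∀ {Xf Ys} → NodeRule Xf Ys → ∀ P Γ
                  → All (λ Y → ⊢ plugP P (Y ++ Γ)) Ys → ⊢ plugP P (fmls Xf ++ Γ)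
  node-rule-sound (axiom-rule p) P Γ [] = from-ctx P Γ _ (ax (toCtx P Γ) p)
  node-rule-sound ⊤-rule         P Γ [] = from-ctx P Γ _ (ax⊤ (toCtx P Γ))
  node-rule-sound (∧-rule A B)   P Γ (d₁ ∷ d₂ ∷ []) =
    from-ctx P Γ _ (r∧ (toCtx P Γ) A B (to-ctx P Γ _ d₁) (to-ctx P Γ _ d₂))
  node-rule-sound (∨-rule A B)   P Γ (d ∷ []) = from-ctx P Γ _ (r∨ (toCtx P Γ) A B (to-ctx P Γ _ d))
  node-rule-sound (□-rule i A)   P Γ (d ∷ []) = from-ctx P Γ _ (r□ (toCtx P Γ) i A (to-ctx P Γ _ d))
  node-rule-sound (cut-rule A m) P Γ (d₁ ∷ d₂ ∷ []) =
    from-ctx P Γ _ (cut (toCtx P Γ) A m (to-ctx P Γ _ d₁) (to-ctx P Γ _ d₂))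

  -- The ◇-rules:  from  F₂, [G₂, Δ]_j  infer  F, [G, Δ]_j  (at any node).
  data ◇Rule : (F G F₂ G₂ : List Fml) → ℕ → Set where
    ◇₁ : ∀ {k j A} → k ≤ j → ◇Rule (◇ k A ∷ []) [] (◇ k A ∷ []) (A ∷ []) j
    ◇₂ : ∀ {k j A} → k ≤ j → ◇Rule (◇ k A ∷ []) [] (◇ k A ∷ []) (◇ k A ∷ []) j
    ◇₃ : ∀ {k j A} → k < j → ◇Rule [] (◇ k A ∷ []) (◇ k A ∷ []) (◇ k A ∷ []) j

  ◇-rule-sound : ∀ {F G F₂ G₂ j} → ◇Rule F G F₂ G₂ j → ∀ P Γ Δ
               → ⊢ plugP P (fmls F₂ ++ bx j (fmls G₂ ++ Δ) ∷ Γ)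
               → ⊢ plugP P (fmls F ++ bx j (fmls G ++ Δ) ∷ Γ)
  ◇-rule-sound (◇₁ kj) P Γ Δ d = from-ctx P Γ _ (r◇₁ (toCtx P Γ) _ _ _ Δ kj (to-ctx P Γ _ d))
  ◇-rule-sound (◇₂ kj) P Γ Δ d = from-ctx P Γ _ (r◇₂ (toCtx P Γ) _ _ _ Δ kj (to-ctx P Γ _ d))
  ◇-rule-sound (◇₃ kj) P Γ Δ d = from-ctx P Γ _ (r◇₃ (toCtx P Γ) _ _ _ Δ kj (to-ctx P Γ _ d))

  SinkStable : (F G F₂ G₂ : List Fml) → ℕ → Set
  SinkStable F G F₂ G₂ j = ∀ P Γ Δ Σ l → j ≤ l
    → ⊢ plugP P (fmls F₂ ++ bx l (bx j (fmls G₂ ++ Δ) ∷ Σ) ∷ Γ)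
    → ⊢ plugP P (fmls F ++ bx l (bx j (fmls G ++ Δ) ∷ Σ) ∷ Γ)

  RiseStable : (F G F₂ G₂ : List Fml) → ℕ → Set
  RiseStable F G F₂ G₂ j = ∀ P Γ Δ Γₙ l → j < l
    → ⊢ plugP P (bx j (fmls G₂ ++ Δ) ∷ bx l (fmls F₂ ++ Γ) ∷ Γₙ)
    → ⊢ plugP P (bx j (fmls G ++ Δ) ∷ bx l (fmls F ++ Γ) ∷ Γₙ)

  record ◇Stability : Set where
    field
      sink-stable : ∀ {F G F₂ G₂ j} → ◇Rule F G F₂ G₂ j → SinkStable F G F₂ G₂ j
      rise-stable : ∀ {F G F₂ G₂ j} → ◇Rule F G F₂ G₂ j → RiseStable F G F₂ G₂ j

-- N S T says that the node S may be transformed into T.  Moves is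
-- inhabited when N moves brackets between nodes; only then can it
-- interfere with a ◇-rule, and ◇-stability is required.

module Lifting
  (N : Seq → Seq → Set)
  (N-resp-~  : ∀ {S₀ S T} → S₀ ~ S → N S T → ∃[ T₀ ] (N S₀ T₀ × T₀ ~ T))
  (N-frame   : ∀ {y S T} → N S T → ∃[ T' ] (N (y ∷ S) T' × T' ~ (y ∷ T)))
  (N-passive : ∀ {A S T} → N (fml A ∷ S) T → ∃[ T₁ ] (N S T₁ × T ~ (fml A ∷ T₁)))
  (Moves : Set)
  where

  data Lift : Seq → Seq → Set where
    root   : ∀ {S T} → N S T → Lift S T
    inside : ∀ {S k D S' D'} → Sel S (bx k D) S' → Lift D D' → Lift S (bx k D' ∷ S')

  LiftTo : Seq → Seq → Set
  LiftTo S U = ∃[ T ] (Lift S T × T ~ U)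

  lifted : ∀ {S T} → Lift S T → LiftTo S T
  lifted {T = T} l = T , l , ~-refl T

  liftTo-~ : ∀ {S U U'} → LiftTo S U → U ~ U' → LiftTo S U'
  liftTo-~ (T , l , r) p = T , l , r ⟫ p

  lift-resp-~ : ∀ {S₀ S T} → S₀ ~ S → Lift S T → LiftTo S₀ T
  lift-resp-~ e (root n) with N-resp-~ e n
  ... | T₀ , n₀ , r = T₀ , root n₀ , r
  lift-resp-~ e (inside s l) with selBx-resp-~ e s
  ... | D₀ , S₀' , s₀ , r , r' with lift-resp-~ r l
  ... | D₀' , l₀ , r'' = _ , inside s₀ l₀ , ~cons (bx≈ _ r'') r'

  lift-frame : ∀ y {S T} → Lift S T → LiftTo (y ∷ S) (y ∷ T)
  lift-frame y (root n) with N-frame n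
  ... | T' , n' , r = T' , root n' , r
  lift-frame y (inside s l) = _ , inside (tl s) l , ~swap

  liftTo-frames : ∀ X {S U} → LiftTo S U → LiftTo (X ++ S) (X ++ U)
  liftTo-frames []      lt = lt
  liftTo-frames (y ∷ X) lt with liftTo-frames X lt
  ... | T , l , r with lift-frame y l
  ... | T' , l' , r' = T' , l' , r' ⟫ ~-∷ y r

  lift-passive : ∀ {A S T} → Lift (fml A ∷ S) T → ∃[ T₁ ] (Lift S T₁ × T ~ (fml A ∷ T₁))
  lift-passive (root n) with N-passive n
  ... | T₁ , n₁ , r = T₁ , root n₁ , r
  lift-passive (inside (tl s) l) = _ , inside s l , ~swap

  lift-passives : ∀ F {S T} → Lift (fmls F ++ S) T → ∃[ T₁ ] (Lift S T₁ × T ~ (fmls F ++ T₁))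
  lift-passives []      l = _ , l , ~-refl _
  lift-passives (A ∷ F) l with lift-passive l
  ... | T₁ , l₁ , r₁ with lift-passives F l₁
  ... | T₂ , l₂ , r₂ = T₂ , l₂ , r₁ ⟫ ~-∷ (fml A) r₂

  lift-path : ∀ P {S T} → Lift S T → Lift (plugP P S) (plugP P T)
  lift-path top        l = l
  lift-path (dn Γ j P) l = inside hd (lift-path P l)

  liftTo-path : ∀ P {S U} → LiftTo S U → LiftTo (plugP P S) (plugP P U)
  liftTo-path P (T , l , r) = _ , lift-path P l , plugP-~ P r

  -- Where an N-step on  plugP P S  happens, relative to the node at P:
  -- within its subtree; elsewhere, relocating the node to a path P' and
  -- adding items E to it; or extracting a bracket from the node to the
  -- parent of its bracket [ ]_l.
  data Position (P : Path) (S : Seq) : Seq → Set where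
    within    : ∀ {T} → Lift S T → Position P S (plugP P T)
    relocates : ∀ {T} P' E → (∀ S' → LiftTo (plugP P S') (plugP P' (E ++ S')))
              → T ~ plugP P' (E ++ S) → Position P S T
    extracts  : ∀ {T} → Moves → ∀ P₀ Γₙ l m D S⁻ → m < l → Sel S (bx m D) S⁻
              → T ~ plugP P₀ (bx m D ∷ bx l S⁻ ∷ Γₙ)
              → (∀ D' S' S'⁻ → Sel S' (bx m D') S'⁻
                   → LiftTo (plugP P S') (plugP P₀ (bx m D' ∷ bx l S'⁻ ∷ Γₙ)))
              → Position P S T

  -- An N-step at the root of  [G, Δ]_j, Γ  (G formulas): it acts on Δ and
  -- Γ uniformly in G, or it sinks the bracket [ ]_j into a sibling.
  data BracketStep (G : List Fml) (j : ℕ) (Δ Γ T : Seq) : Set where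
    around : ∀ Δ' Γ' → (∀ G' → LiftTo (bx j (fmls G' ++ Δ) ∷ Γ) (bx j (fmls G' ++ Δ') ∷ Γ'))
           → T ~ (bx j (fmls G ++ Δ') ∷ Γ') → BracketStep G j Δ Γ T
    sinks  : Moves → ∀ l Σ Γ⁻ → j ≤ l → T ~ (bx l (bx j (fmls G ++ Δ) ∷ Σ) ∷ Γ⁻)
           → (∀ D' → LiftTo (bx j D' ∷ Γ) (bx l (bx j D' ∷ Σ) ∷ Γ⁻))
           → BracketStep G j Δ Γ T

  position-dn : ∀ Γ j P S {T} → Position P S T → Position (dn Γ j P) S (bx j T ∷ Γ)
  position-dn Γ j P S (within l) = within l
  position-dn Γ j P S (relocates P' E f r) =
    relocates (dn Γ j P') E (λ S' → liftTo-path (dn Γ j top) (f S')) (~-bx j Γ r)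
  position-dn Γ j P S (extracts u P₀ Γₙ l m D S⁻ ml s r f) =
    extracts u (dn Γ j P₀) Γₙ l m D S⁻ ml s (~-bx j Γ r)
      (λ D' S' S'⁻ s' → liftTo-path (dn Γ j top) (f D' S' S'⁻ s'))

  module Admissible (𝒞 : List Fml)
    (N-root    : ∀ Γ j P S T → N (bx j (plugP P S) ∷ Γ) T → Position (dn Γ j P) S T)
    (N-bracket : ∀ G j Δ Γ T → N (bx j (fmls G ++ Δ) ∷ Γ) T → BracketStep G j Δ Γ T)
    (stable    : Moves → Rules.◇Stability 𝒞)
    where
    open Rules 𝒞

    classify : ∀ P S T → Lift (plugP P S) T → Position P S T
    classify top        S T l                 = within l
    classify (dn Γ j P) S T (root n)          = N-root Γ j P S T n
    classify (dn Γ j P) S _ (inside hd l)     = position-dn Γ j P S (classify P S _ l)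
    classify (dn Γ j P) S _ (inside (tl s) l) =
      relocates (dn (bx _ _ ∷ _) j P) [] (λ S' → _ , inside (tl s) l , ~swap) ~swap

    -- the induction hypothesis: every N-transform of S is provable
    Admissible : Seq → Set
    Admissible S = ∀ T → Lift S T → ⊢ T

    admissible-to : ∀ {S U} → Admissible S → LiftTo S U → ⊢ U
    admissible-to ih (T , l , r) = exch r (ih T l)

    -- A node rule commutes with every step: transform the premises in the
    -- same way and reapply the rule at the (possibly relocated) node.
    node-rule-admissible : ∀ {Xf Ys} → NodeRule Xf Ys → ∀ P Γ
      → All (λ Y → Admissible (plugP P (Y ++ Γ))) Ys → Admissible (plugP P (fmls Xf ++ Γ))
    node-rule-admissible {Xf} rule P Γ ihs T l = by-position (classify P _ T l)
      where
      conclude : ∀ P' Γ' → (∀ Y → LiftTo (plugP P (Y ++ Γ)) (plugP P' (Y ++ Γ')))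
               → ⊢ plugP P' (fmls Xf ++ Γ')
      conclude P' Γ' f = node-rule-sound rule P' Γ' (All-map (λ {Y} ih → admissible-to ih (f Y)) ihs)

      by-position : ∀ {T} → Position P (fmls Xf ++ Γ) T → ⊢ T
      -- inside the node the step ignores the principal formulas Xf
      by-position (within l') with lift-passives Xf l'
      ... | Γ' , l₁ , r₁ =
        exch (plugP-~ P (~-sym r₁)) (conclude P Γ' (λ Y → liftTo-path P (liftTo-frames Y (lifted l₁))))
      by-position (relocates P' E f r) =
        exch (plugP-~ P' (~-sym (~-exchange E (fmls Xf) Γ)) ⟫ ~-sym r)
          (conclude P' (E ++ Γ) (λ Y → liftTo-~ (f (Y ++ Γ)) (plugP-~ P' (~-exchange E Y Γ))))
      -- an extracted bracket comes from the side Γ, not from Xf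
      by-position (extracts u P₀ Γₙ l m D S⁻ ml s r f) with selBx-past-fmls Xf s
      ... | Γ⁻ , s₁ , refl =
        exch (~-sym (extracted-~ P₀ m D l _ Γₙ) ⟫ ~-sym r)
          (conclude (extend P₀ (bx m D ∷ Γₙ) l) Γ⁻
            (λ Y → liftTo-~ (f D (Y ++ Γ) (Y ++ Γ⁻) (sel-after Y s₁)) (extracted-~ P₀ m D l _ Γₙ)))

    -- The same for ◇-rules, except when the step moves the rule's own
    -- bracket [G, Δ]_j: then ◇-stability re-establishes the conclusion.
    ◇-rule-admissible : ∀ {F G F₂ G₂ j} → ◇Rule F G F₂ G₂ j → ∀ P Γ Δ
      → Admissible (plugP P (fmls F₂ ++ bx j (fmls G₂ ++ Δ) ∷ Γ))
      → Admissible (plugP P (fmls F ++ bx j (fmls G ++ Δ) ∷ Γ))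
    ◇-rule-admissible {F} {G} {F₂} {G₂} {j} rule P Γ Δ ih T l = by-position (classify P _ T l)
      where
      premise : Seq
      premise = fmls F₂ ++ bx j (fmls G₂ ++ Δ) ∷ Γ

      conclude : ∀ P' Γ' Δ' → LiftTo (plugP P premise) (plugP P' (fmls F₂ ++ bx j (fmls G₂ ++ Δ') ∷ Γ'))
               → ⊢ plugP P' (fmls F ++ bx j (fmls G ++ Δ') ∷ Γ')
      conclude P' Γ' Δ' lt = ◇-rule-sound rule P' Γ' Δ' (admissible-to ih lt)

      at-node : ∀ {U} → LiftTo (bx j (fmls G₂ ++ Δ) ∷ Γ) U
              → LiftTo (plugP P premise) (plugP P (fmls F₂ ++ U))
      at-node lt = liftTo-path P (liftTo-frames (fmls F₂) lt)

      in-node : ∀ {T₁} → Lift (bx j (fmls G ++ Δ) ∷ Γ) T₁ → ⊢ plugP P (fmls F ++ T₁)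
      in-node (root n) with N-bracket G j Δ Γ _ n
      ... | around Δ' Γ' f r' =
        exch (plugP-~ P (~-++ (fmls F) (~-sym r'))) (conclude P Γ' Δ' (at-node (f G₂)))
      ... | sinks u k Σ Γ⁻ jk r' f =
        exch (plugP-~ P (~-++ (fmls F) (~-sym r')))
          (◇Stability.sink-stable (stable u) rule P Γ⁻ Δ Σ k jk
            (admissible-to ih (at-node (f (fmls G₂ ++ Δ)))))
      -- inside the rule's bracket the step ignores G
      in-node (inside hd l') with lift-passives G l'
      ... | Δ' , l₁ , r₁ =
        exch (plugP-~ P (~-++ (fmls F) (~-bx j Γ (~-sym r₁))))
          (conclude P Γ Δ' (at-node (liftTo-path (dn Γ j top) (liftTo-frames (fmls G₂) (lifted l₁)))))
      in-node (inside (tl s) l') =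
        exch (plugP-~ P (~-++ (fmls F) ~swap))
          (conclude P _ Δ (at-node (_ , inside (tl s) l' , ~swap)))

      by-position : ∀ {T} → Position P (fmls F ++ bx j (fmls G ++ Δ) ∷ Γ) T → ⊢ T
      by-position (within l') with lift-passives F l'
      ... | T₁ , l₁ , r₁ = exch (plugP-~ P (~-sym r₁)) (in-node l₁)
      by-position (relocates P' E f r) =
        exch (plugP-~ P' (~-sym (~-exchange-past E (fmls F) _ Γ)) ⟫ ~-sym r)
          (conclude P' (E ++ Γ) Δ (liftTo-~ (f premise) (plugP-~ P' (~-exchange-past E (fmls F₂) _ Γ))))
      by-position (extracts u P₀ Γₙ l m D S⁻ ml s r f) with selBx-past-fmls F s
      -- the rule's bracket itself is extracted
      ... | _ , hd , refl =
        exch (~-sym r)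
          (◇Stability.rise-stable (stable u) rule P₀ Γ Δ Γₙ l ml
            (admissible-to ih (f (fmls G₂ ++ Δ) premise _ (sel-after (fmls F₂) hd))))
      ... | Γ⁻ , tl s₁ , refl =
        exch (~-sym (extracted-~ P₀ m D l _ Γₙ) ⟫ ~-sym r)
          (conclude (extend P₀ (bx m D ∷ Γₙ) l) _ Δ
            (liftTo-~ (f D premise _ (sel-after (fmls F₂) (tl s₁))) (extracted-~ P₀ m D l _ Γₙ)))

    at-node-rule : ∀ C {Xf Ys} → NodeRule Xf Ys
      → All (λ Y → Admissible (plug C Y)) Ys → Admissible (plug C (fmls Xf))
    at-node-rule C r ihs =
      subst Admissible (sym (plug-split C _))
        (node-rule-admissible r (pathOf C) (nodeOf C) (All-map (subst Admissible (plug-split C _)) ihs))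

    at-◇-rule : ∀ C {F G F₂ G₂ j} Δ → ◇Rule F G F₂ G₂ j
      → Admissible (plug C (fmls F₂ ++ bx j (fmls G₂ ++ Δ) ∷ []))
      → Admissible (plug C (fmls F ++ bx j (fmls G ++ Δ) ∷ []))
    at-◇-rule C {F} {G} {F₂} {G₂} {j} Δ r ih =
      subst Admissible (sym (to-path F G))
        (◇-rule-admissible r (pathOf C) (nodeOf C) Δ (subst Admissible (to-path F₂ G₂) ih))
      where
      to-path : ∀ H K → plug C (fmls H ++ bx j (fmls K ++ Δ) ∷ [])
                    ≡ plugP (pathOf C) (fmls H ++ bx j (fmls K ++ Δ) ∷ nodeOf C)
      to-path H K = trans (plug-split C _) (cong (plugP (pathOf C)) (++-assoc (fmls H) _ (nodeOf C)))

    admissible : ∀ {S} → ⊢ S → Admissible S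
    admissible (exch e d) T l with lift-resp-~ e l
    ... | T₀ , l₀ , r = exch r (admissible d T₀ l₀)
    admissible (ax C p)      = at-node-rule C (axiom-rule p) []
    admissible (ax⊤ C)       = at-node-rule C ⊤-rule []
    admissible (r∧ C A B d₁ d₂) = at-node-rule C (∧-rule A B) (admissible d₁ ∷ admissible d₂ ∷ [])
    admissible (r∨ C A B d)  = at-node-rule C (∨-rule A B) (admissible d ∷ [])
    admissible (r□ C i A d)  = at-node-rule C (□-rule i A) (admissible d ∷ [])
    admissible (cut C A m d₁ d₂) = at-node-rule C (cut-rule A m) (admissible d₁ ∷ admissible d₂ ∷ [])
    admissible (r◇₁ C k j A Δ kj d) = at-◇-rule C Δ (◇₁ {A = A} kj) (admissible d)
    admissible (r◇₂ C k j A Δ kj d) = at-◇-rule C Δ (◇₂ {A = A} kj) (admissible d)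
    admissible (r◇₃ C k j A Δ kj d) = at-◇-rule C Δ (◇₃ {A = A} kj) (admissible d)

data Weaken (A : Fml) : Seq → Seq → Set where
  add : ∀ {S} → Weaken A S (fml A ∷ S)

module Weakening (𝒞 : List Fml) (A : Fml) where

  weaken-resp-~ : ∀ {S₀ S T} → S₀ ~ S → Weaken A S T → ∃[ T₀ ] (Weaken A S₀ T₀ × T₀ ~ T)
  weaken-resp-~ e add = _ , add , ~-∷ (fml A) e

  weaken-frame : ∀ {y S T} → Weaken A S T → ∃[ T' ] (Weaken A (y ∷ S) T' × T' ~ (y ∷ T))
  weaken-frame add = _ , add , ~swap

  weaken-passive : ∀ {B S T} → Weaken A (fml B ∷ S) T → ∃[ T₁ ] (Weaken A S T₁ × T ~ (fml B ∷ T₁))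
  weaken-passive add = _ , add , ~swap

  open Lifting (Weaken A) weaken-resp-~ weaken-frame weaken-passive ⊥ public

  -- weakening never interacts with the path or with a rule's bracket
  weaken-root : ∀ Γ j P S T → Weaken A (bx j (plugP P S) ∷ Γ) T → Position (dn Γ j P) S T
  weaken-root Γ j P S _ add = relocates (dn (fml A ∷ Γ) j P) [] (λ S' → _ , root add , ~swap) ~swap

  weaken-bracket : ∀ G j Δ Γ T → Weaken A (bx j (fmls G ++ Δ) ∷ Γ) T → BracketStep G j Δ Γ T
  weaken-bracket G j Δ Γ _ add = around Δ (fml A ∷ Γ) (λ G' → _ , root add , ~swap) ~swap

  open Admissible 𝒞 weaken-root weaken-bracket (λ ()) public

  weaken-at : ∀ P S → ⊢[ 𝒞 ] plugP P S → ⊢[ 𝒞 ] plugP P (fml A ∷ S)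
  weaken-at P S d = admissible d _ (lift-path P (root add))

module Diamond (𝒞 : List Fml) where
  open Rules 𝒞
  module W A = Weakening 𝒞 A

  -- The ◇-rules survive moving their bracket: the ◇-formula is first
  -- copied (by weakening) to where it is needed, then the ◇-rules are
  -- applied on both sides of the moved bracket.
  sink-stable : ∀ {F G F₂ G₂ j} → ◇Rule F G F₂ G₂ j → SinkStable F G F₂ G₂ j
  sink-stable (◇₁ {k} {j} {A} kj) P Γ Δ Σ l jl =
    ◇-rule-sound (◇₂ (≤-trans kj jl)) P Γ (bx j Δ ∷ Σ)
    ∘ in-bracket P (fml (◇ k A) ∷ []) l Γ (λ Q → ◇-rule-sound (◇₁ kj) Q Σ Δ ∘ W.weaken-at (◇ k A) Q _)
  sink-stable (◇₂ {k} {j} {A} kj) P Γ Δ Σ l jl =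
    ◇-rule-sound (◇₂ (≤-trans kj jl)) P Γ (bx j Δ ∷ Σ)
    ∘ in-bracket P (fml (◇ k A) ∷ []) l Γ (λ Q → ◇-rule-sound (◇₂ kj) Q Σ Δ ∘ W.weaken-at (◇ k A) Q _)
  sink-stable (◇₃ {k} {j} {A} kj) P Γ Δ Σ l jl =
    in-bracket P [] l Γ (λ Q → ◇-rule-sound (◇₃ kj) Q Σ Δ)
    ∘ ◇-rule-sound (◇₃ (<-≤-trans kj jl)) P Γ (bx j (fml (◇ k A) ∷ Δ) ∷ Σ)
    ∘ in-bracket P (fml (◇ k A) ∷ []) l Γ (λ Q → W.weaken-at (◇ k A) Q _)

  rise-stable : ∀ {F G F₂ G₂ j} → ◇Rule F G F₂ G₂ j → RiseStable F G F₂ G₂ j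
  rise-stable (◇₁ {k} {j} {A} kj) P Γ Δ Γₙ l jl =
    exch (plugP-~ P ~swap)
    ∘ ◇-rule-sound (◇₃ (≤-<-trans kj jl)) P (bx j Δ ∷ Γₙ) Γ
    ∘ exch (plugP-~ P (~-∷ _ ~swap))
    ∘ ◇-rule-sound (◇₁ kj) P (bx l (fml (◇ k A) ∷ Γ) ∷ Γₙ) Δ
    ∘ W.weaken-at (◇ k A) P _
  rise-stable (◇₂ {k} {j} {A} kj) P Γ Δ Γₙ l jl =
    exch (plugP-~ P ~swap)
    ∘ ◇-rule-sound (◇₃ (≤-<-trans kj jl)) P (bx j Δ ∷ Γₙ) Γ
    ∘ exch (plugP-~ P (~-∷ _ ~swap))
    ∘ ◇-rule-sound (◇₂ kj) P (bx l (fml (◇ k A) ∷ Γ) ∷ Γₙ) Δ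
    ∘ W.weaken-at (◇ k A) P _
  rise-stable (◇₃ {k} {j} {A} kj) P Γ Δ Γₙ l jl =
    ◇-rule-sound (◇₃ kj) P (bx l Γ ∷ Γₙ) Δ
    ∘ exch (plugP-~ P (~-∷ _ ~swap))
    ∘ ◇-rule-sound (◇₂ (<⇒≤ (<-trans kj jl))) P (bx j (fml (◇ k A) ∷ Δ) ∷ Γₙ) Γ
    ∘ exch (plugP-~ P (~-∷ _ ~swap))
    ∘ W.weaken-at (◇ k A) P _

  ◇-stability : ◇Stability
  ◇-stability = record { sink-stable = sink-stable ; rise-stable = rise-stable }

data Sink : Seq → Seq → Set where
  sink : ∀ {S m D S₁ l Σ S₂} → Sel S (bx m D) S₁ → Sel S₁ (bx l Σ) S₂ → m ≤ l
       → Sink S (bx l (bx m D ∷ Σ) ∷ S₂)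

module Sinking (𝒞 : List Fml) where

  sink-resp-~ : ∀ {S₀ S T} → S₀ ~ S → Sink S T → ∃[ T₀ ] (Sink S₀ T₀ × T₀ ~ T)
  sink-resp-~ e (sink s s' ml) with selBx-resp-~ e s
  ... | D₀ , S₀₁ , s₀ , rD , r₁ with selBx-resp-~ r₁ s'
  ... | Σ₀ , S₀₂ , s₀' , rΣ , r₂ = _ , sink s₀ s₀' ml , ~cons (bx≈ _ (~cons (bx≈ _ rD) rΣ)) r₂

  sink-frame : ∀ {y S T} → Sink S T → ∃[ T' ] (Sink (y ∷ S) T' × T' ~ (y ∷ T))
  sink-frame (sink s s' ml) = _ , sink (tl s) (tl s') ml , ~swap

  sink-passive : ∀ {A S T} → Sink (fml A ∷ S) T → ∃[ T₁ ] (Sink S T₁ × T ~ (fml A ∷ T₁))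
  sink-passive (sink (tl s) (tl s') ml) = _ , sink s s' ml , ~swap

  open Lifting Sink sink-resp-~ sink-frame sink-passive ⊤ public

  sink-root : ∀ Γ j P S T → Sink (bx j (plugP P S) ∷ Γ) T → Position (dn Γ j P) S T
  -- the bracket on the path sinks into a sibling
  sink-root Γ j P S _ (sink {l = l} {Σ = Σ} {S₂ = Γ₁} hd s' ml) =
    relocates (dn Γ₁ l (dn Σ j P)) [] (λ S' → _ , root (sink hd s' ml) , ~-refl _) (~-refl _)
  -- a sibling sinks into the bracket on the path, which encloses the node
  sink-root Γ j top S _ (sink {D = D} {S₂ = Γ₁} (tl s₁) hd ml) =
    relocates (dn Γ₁ j top) (bx _ D ∷ []) (λ S' → _ , root (sink (tl s₁) hd ml) , ~-refl _) (~-refl _)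
  -- a sibling sinks into the bracket on the path, above the node
  sink-root Γ j (dn Γ₀ j₀ P₀) S _ (sink {D = D} {S₂ = Γ₁} (tl s₁) hd ml) =
    relocates (dn Γ₁ j (dn (bx _ D ∷ Γ₀) j₀ P₀)) []
      (λ S' → _ , root (sink (tl s₁) hd ml) , ~-bx j Γ₁ ~swap) (~-bx j Γ₁ ~swap)
  -- the step happens among the siblings
  sink-root Γ j P S _ (sink {D = D} {l = l} {Σ = Σ} (tl s₁) (tl {S' = Γ₂} s₂) ml) =
    relocates (dn (bx l (bx _ D ∷ Σ) ∷ Γ₂) j P) [] (λ S' → _ , root (sink (tl s₁) (tl s₂) ml) , ~swap) ~swap

  sink-bracket : ∀ G j Δ Γ T → Sink (bx j (fmls G ++ Δ) ∷ Γ) T → BracketStep G j Δ Γ T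
  -- the rule's bracket sinks into a sibling
  sink-bracket G j Δ Γ _ (sink {l = l} {Σ = Σ} {S₂ = Γ⁻} hd s' jl) =
    sinks unit l Σ Γ⁻ jl (~-refl _) (λ D' → _ , root (sink hd s' jl) , ~-refl _)
  -- a sibling sinks into the rule's bracket, joining Δ
  sink-bracket G j Δ Γ _ (sink {D = D} {S₂ = Γ₁} (tl s₁) hd ml) =
    around (bx _ D ∷ Δ) Γ₁
      (λ G' → _ , root (sink (tl s₁) hd ml) , ~-bx j Γ₁ (~-shift _ (fmls G') Δ))
      (~-bx j Γ₁ (~-shift _ (fmls G) Δ))
  -- the step happens among the siblings
  sink-bracket G j Δ Γ _ (sink (tl s₁) (tl s₂) ml) =
    around Δ _ (λ G' → _ , root (sink (tl s₁) (tl s₂) ml) , ~swap) ~swap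

  open Admissible 𝒞 sink-root sink-bracket (λ _ → Diamond.◇-stability 𝒞) public

  bracket-sinks : ∀ P Γ {m D} l Σ → m ≤ l
                → ⊢[ 𝒞 ] plugP P (bx m D ∷ bx l Σ ∷ Γ) → ⊢[ 𝒞 ] plugP P (bx l (bx m D ∷ Σ) ∷ Γ)
  bracket-sinks P Γ l Σ ml d = admissible d _ (lift-path P (root (sink hd hd ml)))

data Rise : Seq → Seq → Set where
  rise : ∀ {S l Σ S₁ m D Σ₁} → Sel S (bx l Σ) S₁ → Sel Σ (bx m D) Σ₁ → m < l
       → Rise S (bx m D ∷ bx l Σ₁ ∷ S₁)

module Rising (𝒞 : List Fml) where

  rise-resp-~ : ∀ {S₀ S T} → S₀ ~ S → Rise S T → ∃[ T₀ ] (Rise S₀ T₀ × T₀ ~ T)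
  rise-resp-~ e (rise s s' ml) with selBx-resp-~ e s
  ... | Σ₀ , S₀₁ , s₀ , rΣ , r₁ with selBx-resp-~ rΣ s'
  ... | D₀ , Σ₀₁ , s₀' , rD , r₂ = _ , rise s₀ s₀' ml , ~cons (bx≈ _ rD) (~cons (bx≈ _ r₂) r₁)

  rise-frame : ∀ {y S T} → Rise S T → ∃[ T' ] (Rise (y ∷ S) T' × T' ~ (y ∷ T))
  rise-frame (rise s s' ml) = _ , rise (tl s) s' ml , ~-rot _ _ _ _

  rise-passive : ∀ {A S T} → Rise (fml A ∷ S) T → ∃[ T₁ ] (Rise S T₁ × T ~ (fml A ∷ T₁))
  rise-passive (rise (tl s) s' ml) = _ , rise s s' ml , ~-rot _ _ _ _

  open Lifting Rise rise-resp-~ rise-frame rise-passive ⊤ public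

  rise-root : ∀ Γ j P S T → Rise (bx j (plugP P S) ∷ Γ) T → Position (dn Γ j P) S T
  -- a bracket rises out of the node itself
  rise-root Γ j top S _ (rise {D = D} {Σ₁ = S⁻} hd s' ml) =
    extracts unit top Γ j _ D S⁻ ml s' (~-refl _) (λ D' S' S'⁻ s'' → _ , root (rise hd s'' ml) , ~-refl _)
  -- the second bracket on the path rises out of the first
  rise-root Γ j (dn Γ₀ j₀ P₀) S _ (rise hd hd ml) =
    relocates (dn (bx j Γ₀ ∷ Γ) j₀ P₀) [] (λ S' → _ , root (rise hd hd ml) , ~-refl _) (~-refl _)
  -- another bracket rises out of the first bracket on the path
  rise-root Γ j (dn Γ₀ j₀ P₀) S _ (rise {D = D} hd (tl {S' = Γ₀'} s₃) ml) =
    relocates (dn (bx _ D ∷ Γ) j (dn Γ₀' j₀ P₀)) [] (λ S' → _ , root (rise hd (tl s₃) ml) , ~swap) ~swap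
  -- the step happens among the siblings
  rise-root Γ j P S _ (rise {l = l} {D = D} {Σ₁ = Σ₁} (tl {S' = Γ₁} s₁) s' ml) =
    relocates (dn (bx _ D ∷ bx l Σ₁ ∷ Γ₁) j P) []
      (λ S' → _ , root (rise (tl s₁) s' ml) , ~-rot _ _ _ _) (~-rot _ _ _ _)

  rise-bracket : ∀ G j Δ Γ T → Rise (bx j (fmls G ++ Δ) ∷ Γ) T → BracketStep G j Δ Γ T
  -- a bracket rises out of Δ in the rule's bracket
  rise-bracket G j Δ Γ _ (rise {D = D} hd s' ml) with selBx-past-fmls G s'
  ... | Δ⁻ , s₂ , refl =
    around Δ⁻ (bx _ D ∷ Γ) (λ G' → _ , root (rise hd (sel-after (fmls G') s₂) ml) , ~swap) ~swap
  -- the step happens among the siblings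
  rise-bracket G j Δ Γ _ (rise (tl s₁) s' ml) =
    around Δ _ (λ G' → _ , root (rise (tl s₁) s' ml) , ~-rot _ _ _ _) (~-rot _ _ _ _)

  open Admissible 𝒞 rise-root rise-bracket (λ _ → Diamond.◇-stability 𝒞) public

  bracket-rises : ∀ P Γ {m D} l Σ → m < l
                → ⊢[ 𝒞 ] plugP P (bx l (bx m D ∷ Σ) ∷ Γ) → ⊢[ 𝒞 ] plugP P (bx m D ∷ bx l Σ ∷ Γ)
  bracket-rises P Γ l Σ ml d = admissible d _ (lift-path P (root (rise hd hd ml)))

module Moving (𝒞 : List Fml) (i : ℕ) (Δ : Seq) where
  open Rules 𝒞
  open Sinking 𝒞 using (bracket-sinks)
  open Rising 𝒞 using (bracket-rises)

  B : Item
  B = bx i Δ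

  sink-along : ∀ P Γ j C → All (i ≤_) (j ∷ labels C)
             → ⊢ plugP P (B ∷ bx j (plug C []) ∷ Γ) → ⊢ plugP P (bx j (plug C (B ∷ [])) ∷ Γ)
  sink-along P Γ j (here Σ)     (ij ∷ [])   = bracket-sinks P Γ j Σ ij
  sink-along P Γ j (down Σ k C) (ij ∷ path) =
    in-bracket P [] j Γ (λ Q → sink-along Q Σ k C path) ∘ bracket-sinks P Γ j _ ij

  rise-along : ∀ P Γ j C → All (i <_) (j ∷ labels C)
             → ⊢ plugP P (bx j (plug C (B ∷ [])) ∷ Γ) → ⊢ plugP P (B ∷ bx j (plug C []) ∷ Γ)
  rise-along P Γ j (here Σ)     (ij ∷ [])   = bracket-rises P Γ j Σ ij
  rise-along P Γ j (down Σ k C) (ij ∷ path) =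
    bracket-rises P Γ j _ ij ∘ in-bracket P [] j Γ (λ Q → rise-along Q Σ k C path)

  -- by the shape of the two-hole context: an i-path rises to the common
  -- ancestor and then sinks
  move : ∀ P Γ → IPath i Γ → ⊢ plugP P (fill2 Γ (B ∷ []) []) → ⊢ plugP P (fill2 Γ [] (B ∷ []))
  move P (both Γ)            _          = id
  move P (hereThere Γ j C)   path       = sink-along P Γ j C path
  move P (thereHere Γ j C)   path       = rise-along P Γ j C path
  move P (split Γ j C k D)   (up , dwn) =
    exch (plugP-~ P ~swap)
    ∘ sink-along P (bx j (plug C []) ∷ Γ) k D dwn
    ∘ exch (plugP-~ P (~-∷ B ~swap))
    ∘ rise-along P (bx k (plug D []) ∷ Γ) j C up
  move P (down2 Γ j C)       path       = in-bracket P [] j Γ (λ Q → move Q C path)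

lemma7 : (𝒞 : List Fml) → Adequate 𝒞 → (i : ℕ) (Γ : Ctx2) → IPath i Γ → (Δ : Seq)
    → ⊢[ 𝒞 ] fill2 Γ (bx i Δ ∷ []) []
    → ⊢[ 𝒞 ] fill2 Γ [] (bx i Δ ∷ [])
lemma7 𝒞 _ i Γ path Δ = Moving.move 𝒞 i Δ top Γ path
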